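{- For every finite-dimensional poset $P$, $$\mathrm{abs}(P)\ \leq\ \dim(P)-\mathrm{bd\text{ - }dim}(P).$$
   Context: Posets (in particular chains) are nonempty; products carry the componentwise order. The dimension $\dim(R)$ of a poset $R$ is the least cardinal $\kappa$ such that $R$ order-embeds into a product of $\kappa$ chains. For a finite-dimensional poset $R$, $\mathrm{abs}(R)$ is the largest natural number $n$ such that $\dim(R\times\prod_{i=0}^{n-1}T_i)=\dim(R)$ for every $n$-tuple of chains $(T_i)$. A poset is bounded if it has a greatest and a least element; $\mathrm{bd\text{ - }dim}(R)$ is the greatest integer $n$ such that $R$ contains a bounded subposet of dimension $n$. -}

module Defs where

open import Level using (Level; _⊔_)
open import Data.Nat using (ℕ; _≤_)
open import Data.Fin using (Fin)
open import Data.Product using (Σ; ∃; _×_; _,_; proj₁; proj₂)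
open import Data.Product.Relation.Binary.Pointwise.NonDependent using (×-poset)
open import Relation.Binary.Bundles using (Poset; TotalOrder)
open import Relation.Binary.Structures using (IsPartialOrder; IsPreorder; IsEquivalence)

record Chain (c ℓ₁ ℓ₂ : Level) : Set (Level.suc (c ⊔ ℓ₁ ⊔ ℓ₂)) where
  field
    order : TotalOrder c ℓ₁ ℓ₂
    point : TotalOrder.Carrier order

chainPoset : ∀ {c ℓ₁ ℓ₂} → Chain c ℓ₁ ℓ₂ → Poset c ℓ₁ ℓ₂
chainPoset T = TotalOrder.poset (Chain.order T)

Π-poset : ∀ {c ℓ₁ ℓ₂} {n : ℕ} → (Fin n → Poset c ℓ₁ ℓ₂) → Poset c ℓ₁ ℓ₂
Π-poset {n = n} P = record
  { Carrier = (i : Fin n) → Poset.Carrier (P i)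
  ; _≈_ = λ f g → ∀ i → Poset._≈_ (P i) (f i) (g i)
  ; _≤_ = λ f g → ∀ i → Poset._≤_ (P i) (f i) (g i)
  ; isPartialOrder = record
    { isPreorder = record
      { isEquivalence = record
        { refl = λ i → Poset.Eq.refl (P i)
        ; sym = λ p i → Poset.Eq.sym (P i) (p i)
        ; trans = λ p q i → Poset.Eq.trans (P i) (p i) (q i)
        }
      ; reflexive = λ p i → Poset.reflexive (P i) (p i)
      ; trans = λ p q i → Poset.trans (P i) (p i) (q i)
      }
    ; antisym = λ p q i → Poset.antisym (P i) (p i) (q i)
    }
  }

ΠChains : ∀ {c ℓ₁ ℓ₂} {n : ℕ} → (Fin n → Chain c ℓ₁ ℓ₂) → Poset c ℓ₁ ℓ₂
ΠChains T = Π-poset (λ i → chainPoset (T i))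

OrderEmbeds : ∀ {c ℓ₁ ℓ₂ c' ℓ₁' ℓ₂'} → Poset c ℓ₁ ℓ₂ → Poset c' ℓ₁' ℓ₂' → Set _
OrderEmbeds P Q =
  Σ (Poset.Carrier P → Poset.Carrier Q) λ f →
    ∀ x y → (Poset._≤_ P x y → Poset._≤_ Q (f x) (f y))
          × (Poset._≤_ Q (f x) (f y) → Poset._≤_ P x y)

EmbedsInChains : ∀ {c ℓ₁ ℓ₂} → Poset c ℓ₁ ℓ₂ → ℕ → Set _
EmbedsInChains {c} {ℓ₁} {ℓ₂} P k =
  Σ (Fin k → Chain c ℓ₁ ℓ₂) λ T → OrderEmbeds P (ΠChains T)

IsDim : ∀ {c ℓ₁ ℓ₂} → Poset c ℓ₁ ℓ₂ → ℕ → Set _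
IsDim P d = EmbedsInChains P d × (∀ m → EmbedsInChains P m → d ≤ m)

_×Chains_ : ∀ {c ℓ₁ ℓ₂} {n : ℕ} → Poset c ℓ₁ ℓ₂ → (Fin n → Chain c ℓ₁ ℓ₂) → Poset c ℓ₁ ℓ₂
P ×Chains T = ×-poset P (ΠChains T)

-- n is admissible for abs(P) (where dim(P) = d): for every n-tuple of chains
-- (T_i), dim(P × ∏ T_i) = dim(P).  abs(P) is the largest admissible n.
AbsAdmissible : ∀ {c ℓ₁ ℓ₂} → Poset c ℓ₁ ℓ₂ → ℕ → ℕ → Set _
AbsAdmissible {c} {ℓ₁} {ℓ₂} P d n = (T : Fin n → Chain c ℓ₁ ℓ₂) → IsDim (P ×Chains T) d

SubPoset : ∀ {c ℓ₁ ℓ₂} (P : Poset c ℓ₁ ℓ₂) → (Poset.Carrier P → Set c) → Poset c ℓ₁ ℓ₂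
SubPoset P S = record
  { Carrier = Σ (Poset.Carrier P) S
  ; _≈_ = λ x y → Poset._≈_ P (proj₁ x) (proj₁ y)
  ; _≤_ = λ x y → Poset._≤_ P (proj₁ x) (proj₁ y)
  ; isPartialOrder = record
    { isPreorder = record
      { isEquivalence = record
        { refl = Poset.Eq.refl P
        ; sym = Poset.Eq.sym P
        ; trans = Poset.Eq.trans P
        }
      ; reflexive = Poset.reflexive P
      ; trans = Poset.trans P
      }
    ; antisym = Poset.antisym P
    }
  }

Bounded : ∀ {c ℓ₁ ℓ₂} → Poset c ℓ₁ ℓ₂ → Set _
Bounded P =
  (Σ (Poset.Carrier P) λ ⊤ → ∀ x → Poset._≤_ P x ⊤) ×
  (Σ (Poset.Carrier P) λ ⊥ → ∀ x → Poset._≤_ P ⊥ x)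

-- P contains a bounded subposet of dimension b.  bd-dim(P) is the greatest such b.
HasBoundedSubposetOfDim : ∀ {c ℓ₁ ℓ₂} → Poset c ℓ₁ ℓ₂ → ℕ → Set _
HasBoundedSubposetOfDim P b =
  Σ (Poset.Carrier P → Set _) λ S → Bounded (SubPoset P S) × IsDim (SubPoset P S) b

-- If X has a top ⊤ and a bottom ⊥ and g order-embeds X × 2 into a product of chains, then
-- g(⊤,0) is not above g(⊥,1), so some coordinate j has g(⊤,0)ⱼ ≤ g(⊥,1)ⱼ.  Deleting that
-- coordinate from x ↦ g(x,0) still gives an embedding, because the missing comparison
-- g(x,0)ⱼ ≤ g(⊤,0)ⱼ ≤ g(⊥,1)ⱼ ≤ g(y,1)ⱼ comes for free and g(x,0) ≤ g(y,1) forces x ≤ y.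
-- So every factor 2 beside a bounded poset costs one chain.  A bounded subposet Q of P gives
-- Q × 2^a ⊆ P × 2^a, which embeds into d chains; hence Q embeds into d − a chains and b ≤ d − a.
module Submission where

open import Defs
open import Level using (Level; Lift; lift; lower)
open import Function using (_∘_; id)
open import Data.Nat using (ℕ; zero; suc; _≤_; _∸_; _+_)
open import Data.Nat.Properties using (+-monoʳ-≤; m+n≤o⇒m≤o∸n; ≤-reflexive; ≤-trans)
open import Data.Bool using (Bool; true; false; b≤b; f≤t) renaming (_≤_ to _≤ᵇ_)
import Data.Bool.Properties as Bool
open import Data.Fin using (Fin; zero; suc; punchIn; punchOut; _≟_)
open import Data.Fin.Properties using (punchIn-punchOut; ∀-cons)
open import Data.Product using (∃; ∃-syntax; _×_; _,_; proj₁; proj₂)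
open import Data.Product.Relation.Binary.Pointwise.NonDependent using (×-poset)
open import Data.Sum as Sum using (_⊎_; inj₁; inj₂)
open import Relation.Binary.Bundles using (Poset; TotalOrder)
open import Relation.Binary.PropositionalEquality using (_≡_; refl; sym; trans; subst)
open import Relation.Nullary using (yes; no)

Fin-∃⊎∀ : ∀ {m p q} {A : Fin m → Set p} {B : Fin m → Set q} →
          (∀ j → A j ⊎ B j) → ∃ A ⊎ (∀ j → B j)
Fin-∃⊎∀ {zero}  _ = inj₂ λ ()
Fin-∃⊎∀ {suc m} h with h zero | Fin-∃⊎∀ (h ∘ suc)
... | inj₁ a₀ | _              = inj₁ (zero , a₀)
... | inj₂ _  | inj₁ (j , aⱼ)  = inj₁ (suc j , aⱼ)
... | inj₂ b₀ | inj₂ bₛ        = inj₂ (∀-cons b₀ bₛ)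

module _ {c ℓ₁ ℓ₂ : Level} where

  𝟚 : Chain c ℓ₁ ℓ₂
  𝟚 = record
    { order = record
      { Carrier = Lift c Bool
      ; _≈_ = λ x y → Lift ℓ₁ (lower x ≡ lower y)
      ; _≤_ = λ x y → Lift ℓ₂ (lower x ≤ᵇ lower y)
      ; isTotalOrder = record
        { isPartialOrder = record
          { isPreorder = record
            { isEquivalence = record
              { refl = lift refl
              ; sym = λ p → lift (sym (lower p))
              ; trans = λ p q → lift (trans (lower p) (lower q))
              }
            ; reflexive = λ p → lift (Bool.≤-reflexive (lower p))
            ; trans = λ p q → lift (Bool.≤-trans (lower p) (lower q))
            }
          ; antisym = λ p q → lift (Bool.≤-antisym (lower p) (lower q))
          }
        ; total = λ x y → Sum.map lift lift (Bool.≤-total (lower x) (lower y))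
        }
      }
    ; point = lift false
    }

  𝟚ⁿ : (n : ℕ) → Fin n → Chain c ℓ₁ ℓ₂
  𝟚ⁿ _ _ = 𝟚

  _×𝟚 : Poset c ℓ₁ ℓ₂ → Poset c ℓ₁ ℓ₂
  X ×𝟚 = ×-poset X (chainPoset 𝟚)

  𝟚-bounded : Bounded (chainPoset 𝟚)
  𝟚-bounded = (lift true , λ x → lift (Bool.≤-maximum (lower x)))
            , (lift false , λ x → lift (Bool.≤-minimum (lower x)))

  ×-bounded : (X Y : Poset c ℓ₁ ℓ₂) → Bounded X → Bounded Y → Bounded (×-poset X Y)
  ×-bounded _ _ ((⊤X , ≤⊤X) , (⊥X , ⊥X≤)) ((⊤Y , ≤⊤Y) , (⊥Y , ⊥Y≤)) =
    ((⊤X , ⊤Y) , λ (x , y) → ≤⊤X x , ≤⊤Y y) , ((⊥X , ⊥Y) , λ (x , y) → ⊥X≤ x , ⊥Y≤ y)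

  Π-bounded : ∀ {n} (P : Fin n → Poset c ℓ₁ ℓ₂) → (∀ i → Bounded (P i)) → Bounded (Π-poset P)
  Π-bounded _ b = ((λ i → proj₁ (proj₁ (b i))) , λ f i → proj₂ (proj₁ (b i)) (f i))
                , ((λ i → proj₁ (proj₂ (b i))) , λ f i → proj₂ (proj₂ (b i)) (f i))

  Π-≤-punchIn : ∀ {m} (P : Fin (suc m) → Poset c ℓ₁ ℓ₂) {f g : Poset.Carrier (Π-poset P)} j →
                Poset._≤_ (P j) (f j) (g j) →
                (∀ i → Poset._≤_ (P (punchIn j i)) (f (punchIn j i)) (g (punchIn j i))) →
                Poset._≤_ (Π-poset P) f g
  Π-≤-punchIn P {f} {g} j fⱼ≤gⱼ rest k with j ≟ k
  ... | yes refl = fⱼ≤gⱼ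
  ... | no j≢k   = subst (λ k → Poset._≤_ (P k) (f k) (g k)) (punchIn-punchOut j≢k) (rest (punchOut j≢k))

  SubPoset-embeds : (P : Poset c ℓ₁ ℓ₂) (S : Poset.Carrier P → Set c) → OrderEmbeds (SubPoset P S) P
  SubPoset-embeds P S = proj₁ , λ _ _ → id , id

  ×-embedsˡ : (X Y Z : Poset c ℓ₁ ℓ₂) → OrderEmbeds X Y → OrderEmbeds (×-poset X Z) (×-poset Y Z)
  ×-embedsˡ _ _ _ (f , f-emb) =
    (λ (x , z) → f x , z) ,
    λ (x , _) (y , _) → (λ (x≤y , z≤z′) → proj₁ (f-emb x y) x≤y , z≤z′)
                      , (λ (fx≤fy , z≤z′) → proj₂ (f-emb x y) fx≤fy , z≤z′)

  ×Chains-zero-embeds : (B : Poset c ℓ₁ ℓ₂) (T : Fin 0 → Chain c ℓ₁ ℓ₂) →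
                        OrderEmbeds B (B ×Chains T)
  ×Chains-zero-embeds _ _ = (λ b → b , λ ()) , λ _ _ → (λ b≤b′ → b≤b′ , λ ()) , proj₁

  ×Chains-suc-embeds : ∀ {n} (B : Poset c ℓ₁ ℓ₂) (T : Fin (suc n) → Chain c ℓ₁ ℓ₂) →
                       OrderEmbeds (×-poset (B ×Chains (T ∘ suc)) (chainPoset (T zero))) (B ×Chains T)
  ×Chains-suc-embeds _ _ =
    (λ ((b , v) , v₀) → b , ∀-cons v₀ v) ,
    λ _ _ → (λ ((b≤b′ , v≤v′) , v₀≤v₀′) → b≤b′ , ∀-cons v₀≤v₀′ v≤v′)
          , (λ (b≤b′ , v≤v′) → (b≤b′ , v≤v′ ∘ suc) , v≤v′ zero)

  embedsInChains-∘ : (X Y : Poset c ℓ₁ ℓ₂) {m : ℕ} →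
                     OrderEmbeds X Y → EmbedsInChains Y m → EmbedsInChains X m
  embedsInChains-∘ _ _ (f , f-emb) (T , g , g-emb) =
    T , g ∘ f , λ x y → proj₁ (g-emb _ _) ∘ proj₁ (f-emb x y) , proj₂ (f-emb x y) ∘ proj₂ (g-emb _ _)

  drop-coordinate : (X : Poset c ℓ₁ ℓ₂) {m : ℕ} {T : Fin m → Chain c ℓ₁ ℓ₂}
                    (e : OrderEmbeds (X ×𝟚) (ΠChains T)) (j : Fin m) {top bot : Poset.Carrier X} →
                    (∀ x → Poset._≤_ X x top) → (∀ x → Poset._≤_ X bot x) →
                    TotalOrder._≤_ (Chain.order (T j))
                      (proj₁ e (top , lift false) j) (proj₁ e (bot , lift true) j) →
                    ∃[ k ] (m ≡ suc k × EmbedsInChains X k)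
  drop-coordinate X {suc m} {T} (g , g-emb) j {top} {bot} ≤top bot≤ top₀≤bot₁ =
    m , refl , T ∘ punchIn j , g₀ ,
    λ x y → (λ x≤y i → g-mono (x≤y , lift b≤b) (punchIn j i)) , reflect x y
    where
    open Poset X using (Carrier) renaming (_≤_ to _≤X_)
    g-mono : ∀ {u v} → Poset._≤_ (X ×𝟚) u v → Poset._≤_ (ΠChains T) (g u) (g v)
    g-mono = proj₁ (g-emb _ _)
    g₀ : Carrier → Poset.Carrier (ΠChains (T ∘ punchIn j))
    g₀ x i = g (x , lift false) (punchIn j i)
    reflect : ∀ x y → Poset._≤_ (ΠChains (T ∘ punchIn j)) (g₀ x) (g₀ y) → x ≤X y
    reflect x y g₀x≤g₀y =
      proj₁ (proj₂ (g-emb (x , lift false) (y , lift true)) (Π-≤-punchIn (chainPoset ∘ T) j atJ offJ))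
      where
      atJ : TotalOrder._≤_ (Chain.order (T j)) (g (x , lift false) j) (g (y , lift true) j)
      atJ = TotalOrder.trans (Chain.order (T j)) (g-mono (≤top x , lift b≤b) j)
              (TotalOrder.trans (Chain.order (T j)) top₀≤bot₁ (g-mono (bot≤ y , lift b≤b) j))
      offJ : ∀ i → TotalOrder._≤_ (Chain.order (T (punchIn j i)))
                     (g (x , lift false) (punchIn j i)) (g (y , lift true) (punchIn j i))
      offJ i = TotalOrder.trans (Chain.order (T (punchIn j i)))
                 (g₀x≤g₀y i) (g-mono (Poset.refl X , lift f≤t) (punchIn j i))

  drop-𝟚 : (X : Poset c ℓ₁ ℓ₂) {m : ℕ} → Bounded X → EmbedsInChains (X ×𝟚) m →
           ∃[ k ] (m ≡ suc k × EmbedsInChains X k)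
  drop-𝟚 X ((top , ≤top) , (bot , bot≤)) (T , e@(g , g-emb))
    with Fin-∃⊎∀ (λ j → TotalOrder.total (Chain.order (T j)) (g (top , lift false) j) (g (bot , lift true) j))
  ... | inj₁ (j , top₀≤bot₁) = drop-coordinate X {T = T} e j ≤top bot≤ top₀≤bot₁
  ... | inj₂ bot₁≤top₀ with proj₂ (proj₂ (g-emb (bot , lift true) (top , lift false)) bot₁≤top₀)
  ... | lift ()

  drop-𝟚ⁿ : (B : Poset c ℓ₁ ℓ₂) (a : ℕ) {m : ℕ} → Bounded B →
            EmbedsInChains (B ×Chains 𝟚ⁿ a) m → ∃[ k ] (a + k ≡ m × EmbedsInChains B k)
  drop-𝟚ⁿ B zero {m} _ e =
    m , refl , embedsInChains-∘ B (B ×Chains 𝟚ⁿ 0) (×Chains-zero-embeds B (𝟚ⁿ 0)) e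
  drop-𝟚ⁿ B (suc a) bounded e
    with drop-𝟚 (B ×Chains 𝟚ⁿ a) B×𝟚ᵃ-bounded
                (embedsInChains-∘ ((B ×Chains 𝟚ⁿ a) ×𝟚) (B ×Chains 𝟚ⁿ (suc a)) unfold e)
    where
    B×𝟚ᵃ-bounded : Bounded (B ×Chains 𝟚ⁿ a)
    B×𝟚ᵃ-bounded =
      ×-bounded B (ΠChains (𝟚ⁿ a)) bounded (Π-bounded (chainPoset ∘ 𝟚ⁿ a) λ _ → 𝟚-bounded)
    unfold : OrderEmbeds ((B ×Chains 𝟚ⁿ a) ×𝟚) (B ×Chains 𝟚ⁿ (suc a))
    unfold = ×Chains-suc-embeds B (𝟚ⁿ (suc a))
  ... | _ , refl , e′ with drop-𝟚ⁿ B a bounded e′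
  ... | k , refl , e″ = k , refl , e″

mainTheorem8 : ∀ {c ℓ₁ ℓ₂ : Level} (P : Poset c ℓ₁ ℓ₂) (d : ℕ) → IsDim P d →
               ∀ (a : ℕ) → AbsAdmissible P d a →
               ∀ (b : ℕ) → HasBoundedSubposetOfDim P b →
               a ≤ d ∸ b
mainTheorem8 {c} {ℓ₁} {ℓ₂} P d _ a admissible b (S , bounded , (_ , dim-minimal)) =
  let k , a+k≡d , Q-embeds = drop-𝟚ⁿ Q a bounded Q×𝟚ᵃ-embeds in
  m+n≤o⇒m≤o∸n a (≤-trans (+-monoʳ-≤ a (dim-minimal k Q-embeds)) (≤-reflexive a+k≡d))
  where
  Q : Poset c ℓ₁ ℓ₂
  Q = SubPoset P S
  Q×𝟚ᵃ↪P×𝟚ᵃ : OrderEmbeds (Q ×Chains 𝟚ⁿ a) (P ×Chains 𝟚ⁿ a)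
  Q×𝟚ᵃ↪P×𝟚ᵃ = ×-embedsˡ Q P (ΠChains (𝟚ⁿ a)) (SubPoset-embeds P S)
  Q×𝟚ᵃ-embeds : EmbedsInChains (Q ×Chains 𝟚ⁿ a) d
  Q×𝟚ᵃ-embeds =
    embedsInChains-∘ (Q ×Chains 𝟚ⁿ a) (P ×Chains 𝟚ⁿ a) Q×𝟚ᵃ↪P×𝟚ᵃ (proj₁ (admissible (𝟚ⁿ a)))
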